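{- Let $d>1$ be a squarefree integer with $d\equiv 3\pmod 4$, $K=\mathbb{Q}(\sqrt d)$, and let $d_1,d_2$ be positive integers with $d=d_1d_2$ and $d_1<d_2$. Write $d_1=p_1\cdots p_r$, $d_2=q_1\cdots q_s$ (prime factorizations), let $P,P_i,Q_j$ be the unique prime ideals of $O_K$ above $2,p_i,q_j$, and set $I_1=PP_1\cdots P_r$, $I_2=PQ_1\cdots Q_s$. Then $I_1$ and $I_2$ are PWR ideals if and only if $d_2\le 3d_1$ and the equation $k^2d_2-\ell^2d_1=\pm2$ has an integer solution $(k,\ell)$ (for some choice of sign). Moreover, in that case, for $i=1,2$ the elements $d_i+\sqrt d,\ d_i-\sqrt d$ form a minimal basis of $I_i$.
   Context: $\Lambda:K\to\mathbb{R}^2$, $\Lambda(\alpha)=(\sigma_1(\alpha),\sigma_2(\alpha))$ where $\sigma_{1,2}(x+y\sqrt d)=x\pm y\sqrt d$. A lattice in $\mathbb{R}^2$ is well-rounded (WR) if its nonzero vectors of minimal Euclidean length span $\mathbb{R}^2$; a basis of a WR lattice consisting of two minimal vectors is a minimal basis. An ideal $I$ of $O_K$ is WR if $\Lambda(I)$ is WR, and PWR if it is principal and WR; $\alpha,\beta\in I$ form a minimal basis of $I$ if $\Lambda(\alpha),\Lambda(\beta)$ form a minimal basis of $\Lambda(I)$. -}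

module Defs where

open import Data.Nat as ℕ using (ℕ; zero; suc)
open import Data.Nat.Primality using (Prime)
open import Data.Nat.Divisibility using (_∣_)
open import Data.Integer as ℤ using (ℤ; +_)
open import Data.Fin using (Fin; zero; suc)
open import Data.Product using (Σ; ∃; ∃-syntax; _×_; _,_)
open import Data.Unit using (⊤)
open import Data.Sum using (_⊎_)
open import Relation.Binary.PropositionalEquality using (_≡_; _≢_)
open import Relation.Nullary using (¬_)
open import Function.Bundles using (_⇔_)

SquareFree : ℕ → Set
SquareFree n = ∀ m → m ℕ.* m ∣ n → m ≡ 1

-- Since d ≡ 3 (mod 4), O_K = ℤ[√d]; the element x + y√d is the pair (x , y).
OK : Set
OK = ℤ × ℤ

module _ (d : ℕ) where
  _·_ : OK → OK → OK
  (a , b) · (c , e) = (a ℤ.* c ℤ.+ + d ℤ.* (b ℤ.* e) , a ℤ.* e ℤ.+ b ℤ.* c)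

_⊕_ : OK → OK → OK
(a , b) ⊕ (c , e) = (a ℤ.+ c , b ℤ.+ e)

0K 1K : OK
0K = (+ 0 , + 0)
1K = (+ 1 , + 0)

ι : ℤ → OK
ι n = (n , + 0)

_⋆_ : ℤ → OK → OK
n ⋆ (a , b) = (n ℤ.* a , n ℤ.* b)

SubK : Set₁
SubK = OK → Set

record IsIdeal (d : ℕ) (I : SubK) : Set where
  field
    has-0   : I 0K
    closed+ : ∀ {a b} → I a → I b → I (a ⊕ b)
    absorb  : ∀ r {a} → I a → I (_·_ d r a)

record IsPrimeIdeal (d : ℕ) (I : SubK) : Set where
  field
    ideal  : IsIdeal d I
    proper : ¬ I 1K
    prime  : ∀ a b → I (_·_ d a b) → I a ⊎ I b

Above : SubK → ℕ → Set
Above I p = I (ι (+ p))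

data IdealProd (d : ℕ) (I J : SubK) : SubK where
  gen  : ∀ {a b} → I a → J b → IdealProd d I J (_·_ d a b)
  zer  : IdealProd d I J 0K
  plus : ∀ {x y} → IdealProd d I J x → IdealProd d I J y → IdealProd d I J (x ⊕ y)

UnitIdeal : SubK
UnitIdeal _ = ⊤

prodℕ : ∀ {r} → (Fin r → ℕ) → ℕ
prodℕ {zero}  f = 1
prodℕ {suc r} f = f zero ℕ.* prodℕ (λ i → f (suc i))

prodIdeal : (d : ℕ) → ∀ {r} → (Fin r → SubK) → SubK
prodIdeal d {zero}  F = UnitIdeal
prodIdeal d {suc r} F = IdealProd d (F zero) (prodIdeal d (λ i → F (suc i)))

-- |Λ(x + y√d)|² = (x + y√d)² + (x − y√d)² = 2(x² + d y²)
lenSq : ℕ → OK → ℤ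
lenSq d (x , y) = + 2 ℤ.* (x ℤ.* x ℤ.+ + d ℤ.* (y ℤ.* y))

-- Λ(α), Λ(β) linearly independent in ℝ²: det = 2√d (b c − a e), so iff a e − b c ≠ 0
Indep : OK → OK → Set
Indep (a , b) (c , e) = a ℤ.* e ℤ.- b ℤ.* c ≢ + 0

Minimal : ℕ → SubK → OK → Set
Minimal d I α = I α × α ≢ 0K × (∀ β → I β → β ≢ 0K → lenSq d α ℤ.≤ lenSq d β)

-- Λ(I) well-rounded: minimal vectors span ℝ², i.e. two independent minimal vectors exist
WR : ℕ → SubK → Set
WR d I = ∃[ α ] ∃[ β ] (Minimal d I α × Minimal d I β × Indep α β)

Principal : ℕ → SubK → Set
Principal d I = ∃[ γ ] (∀ z → I z ⇔ (∃[ w ] z ≡ _·_ d γ w))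

PWR : ℕ → SubK → Set
PWR d I = Principal d I × WR d I

MinimalBasis : ℕ → SubK → OK → OK → Set
MinimalBasis d I α β =
  WR d I × Minimal d I α × Minimal d I β × Indep α β ×
  (∀ γ → I γ → ∃[ m ] ∃[ n ] γ ≡ (m ⋆ α) ⊕ (n ⋆ β))

module Submission where

-- Since d ≡ 3 (mod 4), O_K = ℤ[√d] and 2 and every pᵢ, qⱼ ramify: P = (2, 1 + √d) consists of the
-- x + y√d with x ≡ y (mod 2), and Pᵢ = (pᵢ, √d) of those with pᵢ ∣ x. Hence I₁ = P P₁ ⋯ P_r is the
-- lattice ℤ(c + √d) + ℤ(c − √d) = {(y + 2b)c + y√d} with c = d₁, of index 2c in O_K, and likewise I₂
-- with c = d₂. For e = d / c, the squared length of (y + 2b)c + y√d is 2(c²(y + 2b)² + d y²): when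
-- e ≤ 3c and c ≤ 3e the vectors c ± √d are shortest, and when e > 3c every vector with y ≠ 0 is longer
-- than 2c, so all minimal vectors are rational and I is not well rounded. A generator γ of I has norm
-- ±2c (comparing the determinants of the bases (γ, γ√d) and (c + √d, c − √d)), and γ = ℓc + k√d gives
-- k²e − ℓ²c = ±2. Conversely, for a solution, k ≡ ℓ (mod 2) by parity, so γ = ℓc + k√d lies in I,
-- and z γ̄ / 2c is integral for every z ∈ I; as γ γ̄ = ∓2c, this makes γ a generator.

open import Defs

-- S = |y + 2b| and T = |y| for the lattice vector (y + 2b)c + y√d, so (S, T) ≠ (0, 0) and S ≡ T (mod 2).
module NormBounds where

  open import Data.Nat
  open import Data.Nat.Properties
  open import Data.Nat.Tactic.RingSolver using (solve-∀)
  open import Relation.Binary.PropositionalEquality using (_≡_; refl; cong)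

  square-mono : ∀ {m n} → m ≤ n → m * m ≤ n * n
  square-mono m≤n = *-mono-≤ m≤n m≤n

  c²+d≤norm : ∀ {c e d S T} → d ≡ c * e → e ≤ 3 * c → c ≤ 3 * e → (T ≡ 0 → 2 ≤ S) → (S ≡ 0 → 2 ≤ T) →
              c * c + d * (1 * 1) ≤ S * c * (S * c) + d * (T * T)
  c²+d≤norm {c} {e} {S = zero} {T} refl _ c≤3e _ 2≤T = begin
    c * c + c * e * (1 * 1)       ≤⟨ +-monoˡ-≤ (c * e * (1 * 1)) (*-monoʳ-≤ c c≤3e) ⟩
    c * (3 * e) + c * e * (1 * 1) ≡⟨ identity c e ⟩
    c * e * (2 * 2)               ≤⟨ *-monoʳ-≤ (c * e) (square-mono (2≤T refl)) ⟩
    c * e * (T * T)               ∎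
    where
    open ≤-Reasoning
    identity : ∀ c e → c * (3 * e) + c * e * (1 * 1) ≡ c * e * (2 * 2)
    identity = solve-∀
  c²+d≤norm {c} {e} {S = suc S} {zero} refl e≤3c _ 2≤S _ = begin
    c * c + c * e * (1 * 1)                   ≤⟨ +-monoʳ-≤ (c * c) (*-monoˡ-≤ (1 * 1) (*-monoʳ-≤ c e≤3c)) ⟩
    c * c + c * (3 * c) * (1 * 1)             ≡⟨ identity c ⟩
    2 * c * (2 * c)                           ≤⟨ square-mono (*-monoˡ-≤ c (2≤S refl)) ⟩
    suc S * c * (suc S * c)                   ≡⟨ +-identityʳ _ ⟨
    suc S * c * (suc S * c) + 0               ≡⟨ cong (suc S * c * (suc S * c) +_) (*-zeroʳ (c * e)) ⟨
    suc S * c * (suc S * c) + c * e * (0 * 0) ∎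
    where
    open ≤-Reasoning
    identity : ∀ c → c * c + c * (3 * c) * (1 * 1) ≡ 2 * c * (2 * c)
    identity = solve-∀
  c²+d≤norm {c} {d = d} {S = suc S} {suc T} _ _ _ _ _ =
    +-mono-≤ (square-mono (m≤n*m c (suc S))) (*-monoʳ-≤ d (square-mono {1} {suc T} (s≤s z≤n)))

  [2c]²<norm : ∀ {c e d S T} → d ≡ c * e → 1 ≤ c → 3 * c < e → 1 ≤ T → (S ≡ 0 → 2 ≤ T) →
               2 * c * (2 * c) + d * (0 * 0) < S * c * (S * c) + d * (T * T)
  [2c]²<norm {c} {e} {S = zero} {T} refl 1≤c 3c<e _ 2≤T = begin-strict
    2 * c * (2 * c) + c * e * (0 * 0) ≡⟨ identity c e ⟩
    c * c * (2 * 2)                   <⟨ *-monoˡ-< (2 * 2) (*-monoʳ-< c {{>-nonZero 1≤c}} c<e) ⟩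
    c * e * (2 * 2)                   ≤⟨ *-monoʳ-≤ (c * e) (square-mono (2≤T refl)) ⟩
    c * e * (T * T)                   ∎
    where
    open ≤-Reasoning
    c<e : c < e
    c<e = ≤-<-trans (m≤n*m c 3) 3c<e
    identity : ∀ c e → 2 * c * (2 * c) + c * e * (0 * 0) ≡ c * c * (2 * 2)
    identity = solve-∀
  [2c]²<norm {c} {e} {S = suc S} {T} refl 1≤c 3c<e 1≤T _ = begin-strict
    2 * c * (2 * c) + c * e * (0 * 0)         ≡⟨ identity c e ⟩
    c * c + c * (3 * c)                       <⟨ +-monoʳ-< (c * c) (*-monoʳ-< c {{>-nonZero 1≤c}} 3c<e) ⟩
    c * c + c * e                             ≤⟨ +-mono-≤ (square-mono (m≤n*m c (suc S)))
                                                          (m≤m*n (c * e) (T * T) {{>-nonZero (*-mono-≤ 1≤T 1≤T)}}) ⟩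
    suc S * c * (suc S * c) + c * e * (T * T) ∎
    where
    open ≤-Reasoning
    identity : ∀ c e → 2 * c * (2 * c) + c * e * (0 * 0) ≡ c * c + c * (3 * c)
    identity = solve-∀

module ℤ[√d] where

  open NormBounds

  open import Data.Nat as ℕ using (ℕ; zero; suc)
  import Data.Nat.Properties as ℕ
  import Data.Nat.Divisibility as ℕ
  import Data.Nat.DivMod as ℕ
  open import Data.Nat.Coprimality using (Coprime; coprime-Bézout)
  open import Data.Nat.GCD using (module Bézout)
  open import Data.Nat.Primality using (Prime; prime⇒irreducible; ¬prime[1])
  open import Data.Integer using (ℤ; +_; -_; -[1+_]; _+_; _*_; _-_; ∣_∣; _≤_; +≤+; ≢-nonZero)
  import Data.Integer.Properties as ℤ
  import Data.Integer.DivMod as ℤ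
  open import Data.Integer.Divisibility.Signed using (_∣_; divides; ∣ᵤ⇒∣; _∣?_; ∣m∣n⇒∣m+n)
  open import Data.Integer.Tactic.RingSolver using (solve-∀; solve)
  open import Data.List using (_∷_; [])
  open import Data.Fin using (Fin; zero; suc)
  open import Data.Product using (∃-syntax; _×_; _,_; proj₁; proj₂)
  open import Data.Sum as Sum using (_⊎_; inj₁; inj₂)
  open import Data.Empty using (⊥-elim)
  open import Data.Unit using (tt)
  open import Function using (_∘_)
  open import Function.Bundles using (_⇔_; mk⇔; Equivalence)
  open import Relation.Binary.PropositionalEquality
  open import Relation.Nullary using (¬_; yes; no)
  open import Relation.Unary using (_⊆_; _≐_)
  open import Relation.Unary.Properties using (≐-trans)

  Odd : ℤ → Set
  Odd n = ∃[ k ] n ≡ k * + 2 + + 1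

  parity : ∀ n → + 2 ∣ n ⊎ Odd n
  parity n with n ℤ./ℕ 2 | n ℤ.%ℕ 2 | ℤ.a≡a%ℕn+[a/ℕn]*n n 2 | ℤ.n%ℕd<d n 2
  ... | q | 0           | n≡ | _ = inj₁ (divides q (trans n≡ (ℤ.+-identityˡ _)))
  ... | q | 1           | n≡ | _ = inj₂ (q , trans n≡ (ℤ.+-comm (+ 1) (q * + 2)))
  ... | _ | suc (suc _) | _  | ℕ.s≤s (ℕ.s≤s ())

  odd≢even : ∀ w q → w * + 2 + + 1 ≢ q * + 2
  odd≢even w q eq = ℕ.even≢odd ∣ q - w ∣ 0 (begin
    2 ℕ.* ∣ q - w ∣             ≡⟨ ℕ.*-comm 2 ∣ q - w ∣ ⟩
    ∣ q - w ∣ ℕ.* 2             ≡⟨ ℤ.abs-* (q - w) (+ 2) ⟨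
    ∣ (q - w) * + 2 ∣           ≡⟨ cong ∣_∣ (trans (cong (_- w * + 2) eq) (sym (identity q w))) ⟨
    ∣ w * + 2 + + 1 - w * + 2 ∣ ≡⟨ cong ∣_∣ (identity′ w) ⟩
    1                           ∎)
    where
    open ≡-Reasoning
    identity : ∀ q w → (q - w) * + 2 ≡ q * + 2 - w * + 2
    identity = solve-∀
    identity′ : ∀ w → w * + 2 + + 1 - w * + 2 ≡ + 1
    identity′ = solve-∀

  relative-parity : ∀ k ℓ → (∃[ t ] ℓ ≡ k + t * + 2) ⊎ (∃[ q ] ℓ ≡ k + (q * + 2 + + 1))
  relative-parity k ℓ = Sum.map (λ (divides t ℓ-k≡) → t , shift ℓ-k≡) (λ (q , ℓ-k≡) → q , shift ℓ-k≡) (parity (ℓ - k))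
    where
    identity : ∀ k ℓ → ℓ ≡ k + (ℓ - k)
    identity = solve-∀
    shift : ∀ {n} → ℓ - k ≡ n → ℓ ≡ k + n
    shift ℓ-k≡n = trans (identity k ℓ) (cong (λ n → k + n) ℓ-k≡n)

  Odd-* : ∀ {C E} → Odd C → Odd E → Odd (C * E)
  Odd-* (c , refl) (e , refl) = c * e * + 2 + c + e , solve (c ∷ e ∷ [])

  Odd-factor : ∀ {m n d} → m ℕ.* n ≡ d → Odd (+ d) → Odd (+ m)
  Odd-factor {m} {n} refl (w , mn≡) with parity (+ m)
  ... | inj₂ m-odd = m-odd
  ... | inj₁ (divides q m≡) = ⊥-elim (odd≢even w (q * + n) (begin
    w * + 2 + + 1 ≡⟨ mn≡ ⟨
    + (m ℕ.* n)   ≡⟨ ℤ.pos-* m n ⟩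
    + m * + n     ≡⟨ cong (_* + n) m≡ ⟩
    q * + 2 * + n ≡⟨ identity q (+ n) ⟩
    q * + n * + 2 ∎))
    where
    open ≡-Reasoning
    identity : ∀ q n → q * + 2 * n ≡ q * n * + 2
    identity = solve-∀

  %4≡3⇒Odd : ∀ {d} → d ℕ.% 4 ≡ 3 → Odd (+ d)
  %4≡3⇒Odd {d} d%4≡3 = + 1 + + q * + 2 , (begin
    + d                           ≡⟨ cong +_ (trans (ℕ.m≡m%n+[m/n]*n d 4) (cong (ℕ._+ q ℕ.* 4) d%4≡3)) ⟩
    + (3 ℕ.+ q ℕ.* 4)             ≡⟨ ℤ.pos-+ 3 (q ℕ.* 4) ⟩
    + 3 + + (q ℕ.* 4)             ≡⟨ cong (λ n → + 3 + n) (ℤ.pos-* q 4) ⟩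
    + 3 + + q * + 4               ≡⟨ identity (+ q) ⟩
    (+ 1 + + q * + 2) * + 2 + + 1 ∎)
    where
    open ≡-Reasoning
    q : ℕ
    q = d ℕ./ 4
    identity : ∀ q → + 3 + q * + 4 ≡ (+ 1 + q * + 2) * + 2 + + 1
    identity = solve-∀

  pos-≡* : ∀ {d} c e → d ≡ c ℕ.* e → + d ≡ + c * + e
  pos-≡* c e d≡ce = trans (cong +_ d≡ce) (ℤ.pos-* c e)

  ∣k∣≡1 : ∀ {k} → ∣ k ∣ ≡ 1 → k ≡ + 1 ⊎ k ≡ - + 1
  ∣k∣≡1 {+ _}      refl = inj₁ refl
  ∣k∣≡1 { -[1+ _ ]} refl = inj₂ refl

  k*δ≡-1 : ∀ {k δ} → k * δ ≡ - + 1 → k ≡ + 1 ⊎ k ≡ - + 1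
  k*δ≡-1 {k} {δ} kδ≡-1 = ∣k∣≡1 (ℕ.m*n≡1⇒m≡1 ∣ k ∣ ∣ δ ∣ (trans (sym (ℤ.abs-* k δ)) (cong ∣_∣ kδ≡-1)))

  ∣b*2∣≥2 : ∀ {b} → b ≢ + 0 → 2 ℕ.≤ ∣ b * + 2 ∣
  ∣b*2∣≥2 {b} b≢0 = subst (2 ℕ.≤_) (sym (ℤ.abs-* b (+ 2)))
    (ℕ.*-monoˡ-≤ 2 (ℕ.n≢0⇒n>0 (λ ∣b∣≡0 → b≢0 (ℤ.∣i∣≡0⇒i≡0 ∣b∣≡0))))

  Bézout-ℕ : ∀ {m n} → Coprime m n → ∃[ X ] ∃[ Y ] X * + m + Y * + n ≡ + 1
  Bézout-ℕ coprime = fromIdentity (coprime-Bézout coprime)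
    where
    toℤ : ∀ a b c e → 1 ℕ.+ a ℕ.* b ≡ c ℕ.* e → + 1 + + a * + b ≡ + c * + e
    toℤ a b c e eq = begin
      + 1 + + a * + b   ≡⟨ cong (λ t → + 1 + t) (ℤ.pos-* a b) ⟨
      + 1 + + (a ℕ.* b) ≡⟨ ℤ.pos-+ 1 (a ℕ.* b) ⟨
      + (1 ℕ.+ a ℕ.* b) ≡⟨ cong +_ eq ⟩
      + (c ℕ.* e)       ≡⟨ ℤ.pos-* c e ⟩
      + c * + e         ∎
      where open ≡-Reasoning
    rearrange : ∀ s t u v → + 1 + s * t ≡ u * v → u * v + - s * t ≡ + 1
    rearrange s t u v eq = trans (cong (_+ - s * t) (sym eq)) (identity s t)
      where
      identity : ∀ s t → + 1 + s * t + - s * t ≡ + 1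
      identity = solve-∀
    fromIdentity : ∀ {m n} → Bézout.Identity 1 m n → ∃[ X ] ∃[ Y ] X * + m + Y * + n ≡ + 1
    fromIdentity {m} {n} (Bézout.+- X Y eq) = + X , - + Y , rearrange (+ Y) (+ n) (+ X) (+ m) (toℤ Y n X m eq)
    fromIdentity {m} {n} (Bézout.-+ X Y eq) =
      - + X , + Y , trans (ℤ.+-comm (- + X * + m) _) (rearrange (+ X) (+ m) (+ Y) (+ n) (toℤ X m Y n eq))

  Bézout-ℤ : ∀ {m} x → Coprime m ∣ x ∣ → ∃[ X ] ∃[ Y ] X * + m + Y * x ≡ + 1
  Bézout-ℤ (+ n) coprime = Bézout-ℕ coprime
  Bézout-ℤ {m} -[1+ n ] coprime with Bézout-ℕ coprime
  ... | X , Y , eq = X , - Y , trans (cong (λ t → X * + m + t) (flip Y (+ suc n))) eq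
    where
    flip : ∀ Y z → - Y * - z ≡ Y * z
    flip = solve-∀

  prime∤⇒coprime : ∀ {p n} → Prime p → ¬ p ℕ.∣ n → Coprime p n
  prime∤⇒coprime p-prime p∤n (k∣p , k∣n) with prime⇒irreducible p-prime k∣p
  ... | inj₁ k≡1 = k≡1
  ... | inj₂ refl = ⊥-elim (p∤n k∣n)

  -- Arithmetic of ℤ[√D]

  infixl 7 _·[_]_

  -- `_·_ d` unfolds to `_·[ + d ]_`; identities are proved for a variable D, which the ring solver
  -- (unlike `+ d`) accepts as an atom.
  _·[_]_ : OK → ℤ → OK → OK
  (a , b) ·[ D ] (a′ , b′) = (a * a′ + D * (b * b′) , a * b′ + b * a′)

  -- r a + s b, written out so that ring normalisation sees through it.
  lin[_] : ℤ → OK → OK → OK → OK → OK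
  lin[ D ] (r , r′) (a , a′) (s , s′) (b , b′) =
    (r * a + D * (r′ * a′) + (s * b + D * (s′ * b′)) , r * a′ + r′ * a + (s * b′ + s′ * b))

  det : OK → OK → ℤ
  det (a , b) (a′ , b′) = a * b′ - b * a′

  N[_] : ℤ → OK → ℤ
  N[ D ] (a , b) = a * a - D * (b * b)

  ·-identityʳ : ∀ D γ → γ ·[ D ] 1K ≡ γ
  ·-identityʳ D (u , v) = cong₂ _,_ (solve (D ∷ u ∷ v ∷ [])) (solve (u ∷ v ∷ []))

  det-· : ∀ D γ α β → det (γ ·[ D ] α) (γ ·[ D ] β) ≡ N[ D ] γ * det α β
  det-· D (u , v) (a , b) (a′ , b′) = identity D u v a b a′ b′
    where
    identity : ∀ D u v a b a′ b′ →
               (u * a + D * (v * b)) * (u * b′ + v * a′) - (u * b + v * a) * (u * a′ + D * (v * b′))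
               ≡ (u * u - D * (v * v)) * (a * b′ - b * a′)
    identity = solve-∀

  det-·√d : ∀ D γ → det γ (γ ·[ D ] (+ 0 , + 1)) ≡ N[ D ] γ
  det-·√d D (u , v) = identity D u v
    where
    identity : ∀ D u v → u * (u * + 1 + v * + 0) - v * (u * + 0 + D * (v * + 1)) ≡ u * u - D * (v * v)
    identity = solve-∀

  det-c±√d : ∀ c → det (c , + 1) (c , - + 1) ≡ - (c * + 2)
  det-c±√d c = identity c
    where
    identity : ∀ c → c * - + 1 - + 1 * c ≡ - (c * + 2)
    identity = solve-∀

  halfLenSq : ℕ → OK → ℕ
  halfLenSq d (x , y) = ∣ x ∣ ℕ.* ∣ x ∣ ℕ.+ d ℕ.* (∣ y ∣ ℕ.* ∣ y ∣)

  lenSq≡ : ∀ d z → lenSq d z ≡ + (2 ℕ.* halfLenSq d z)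
  lenSq≡ d (x , y) = begin
    + 2 * (x * x + + d * (y * y))                            ≡⟨ cong₂ (λ a b → + 2 * (a + + d * b)) (square x) (square y) ⟩
    + 2 * (+ (∣ x ∣ ℕ.* ∣ x ∣) + + d * + (∣ y ∣ ℕ.* ∣ y ∣))     ≡⟨ cong (λ t → + 2 * (+ (∣ x ∣ ℕ.* ∣ x ∣) + t)) (ℤ.pos-* d _) ⟨
    + 2 * (+ (∣ x ∣ ℕ.* ∣ x ∣) + + (d ℕ.* (∣ y ∣ ℕ.* ∣ y ∣))) ≡⟨ cong (+ 2 *_) (ℤ.pos-+ (∣ x ∣ ℕ.* ∣ x ∣) _) ⟨
    + 2 * + halfLenSq d (x , y)                              ≡⟨ ℤ.pos-* 2 (halfLenSq d (x , y)) ⟨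
    + (2 ℕ.* halfLenSq d (x , y))                            ∎
    where
    open ≡-Reasoning
    square : ∀ x → x * x ≡ + (∣ x ∣ ℕ.* ∣ x ∣)
    square (+ n)    = sym (ℤ.pos-* n n)
    square -[1+ n ] = refl

  lenSq-≤ : ∀ {d} α β → halfLenSq d α ℕ.≤ halfLenSq d β → lenSq d α ≤ lenSq d β
  lenSq-≤ {d} α β α≤β = subst₂ _≤_ (sym (lenSq≡ d α)) (sym (lenSq≡ d β)) (+≤+ (ℕ.*-monoʳ-≤ 2 α≤β))

  lenSq-≤⁻ : ∀ {d} α β → lenSq d α ≤ lenSq d β → halfLenSq d α ℕ.≤ halfLenSq d β
  lenSq-≤⁻ {d} α β α≤β = ℕ.*-cancelˡ-≤ 2 (ℤ.drop‿+≤+ (subst₂ _≤_ (lenSq≡ d α) (lenSq≡ d β) α≤β))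

  module _ {d : ℕ} {I : SubK} (I-ideal : IsIdeal d I) where
    open IsIdeal I-ideal

    ∈-lin : ∀ {a b} r s → I a → I b → I (lin[ + d ] r a s b)
    ∈-lin r s a∈I b∈I = closed+ (absorb r a∈I) (absorb s b∈I)

    ι-lin∈ : ∀ {m n} X Y → I (ι m) → I (ι n) → I (ι (X * m + Y * n))
    ι-lin∈ {m} {n} X Y m∈I n∈I = subst I (identity (+ d)) (∈-lin (ι X) (ι Y) m∈I n∈I)
      where
      identity : ∀ D → lin[ D ] (X , + 0) (m , + 0) (Y , + 0) (n , + 0) ≡ (X * m + Y * n , + 0)
      identity D = cong₂ _,_ (solve (D ∷ X ∷ m ∷ Y ∷ n ∷ [])) (solve (X ∷ m ∷ Y ∷ n ∷ []))

    ι-eliminate : ∀ {x y t} → I (x , y) → I (t , + 1) → I (ι (x - y * t))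
    ι-eliminate {x} {y} {t} xy∈I t∈I = subst I (identity (+ d)) (∈-lin 1K (- y , + 0) xy∈I t∈I)
      where
      identity : ∀ D → lin[ D ] (+ 1 , + 0) (x , y) (- y , + 0) (t , + 1) ≡ (x - y * t , + 0)
      identity D = cong₂ _,_ (solve (D ∷ x ∷ y ∷ t ∷ [])) (solve (x ∷ y ∷ t ∷ []))

  module _ {d : ℕ} where

    IdealProd-⊆ : ∀ {I J K : SubK} → K 0K → (∀ {a b} → K a → K b → K (a ⊕ b)) →
                  (∀ {a b} → I a → J b → K (a ·[ + d ] b)) → IdealProd d I J ⊆ K
    IdealProd-⊆ 0∈K +∈K gen∈K (gen a∈I b∈J) = gen∈K a∈I b∈J
    IdealProd-⊆ 0∈K +∈K gen∈K zer           = 0∈K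
    IdealProd-⊆ {I} {J} {K} 0∈K +∈K gen∈K (plus x∈ y∈) =
      +∈K (IdealProd-⊆ {I} {J} {K} 0∈K +∈K gen∈K x∈) (IdealProd-⊆ {I} {J} {K} 0∈K +∈K gen∈K y∈)

    IdealProd-mono : ∀ {I J I′ J′ : SubK} → I ⊆ I′ → J ⊆ J′ → IdealProd d I J ⊆ IdealProd d I′ J′
    IdealProd-mono I⊆ J⊆ = IdealProd-⊆ zer plus (λ a∈I b∈J → gen (I⊆ a∈I) (J⊆ b∈J))

    IdealProd-cong : ∀ {I J I′ J′ : SubK} → I ≐ I′ → J ≐ J′ → IdealProd d I J ≐ IdealProd d I′ J′
    IdealProd-cong (I⊆ , ⊇I) (J⊆ , ⊇J) = IdealProd-mono I⊆ J⊆ , IdealProd-mono ⊇I ⊇J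

  -- The ramified prime ideals

  ⟨2,1+√d⟩ : SubK
  ⟨2,1+√d⟩ (x , y) = ∃[ q ] x ≡ y + q * + 2

  ⟨_,√d⟩ : ℤ → SubK
  ⟨ m ,√d⟩ (x , _) = m ∣ x

  module _ {d : ℕ} {𝔓 : SubK} (𝔓-prime : IsPrimeIdeal d 𝔓) where
    open IsPrimeIdeal 𝔓-prime
    open IsIdeal ideal

    square∈⇒∈ : ∀ {a} → 𝔓 (a ·[ + d ] a) → 𝔓 a
    square∈⇒∈ {a} a²∈𝔓 with prime a a a²∈𝔓
    ... | inj₁ a∈𝔓 = a∈𝔓
    ... | inj₂ a∈𝔓 = a∈𝔓

    above-2≐⟨2,1+√d⟩ : Odd (+ d) → Above 𝔓 2 → 𝔓 ≐ ⟨2,1+√d⟩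
    above-2≐⟨2,1+√d⟩ (k , d≡) 2∈𝔓 = 𝔓⊆ , ⊆𝔓
      where
      square : ∀ {D} → D ≡ k * + 2 + + 1 → (k + + 1 , + 1) ·[ D ] (+ 2 , + 0) ≡ (+ 1 , + 1) ·[ D ] (+ 1 , + 1)
      square refl = cong₂ _,_ (solve (k ∷ [])) (solve (k ∷ []))

      1+√d∈𝔓 : 𝔓 (+ 1 , + 1)
      1+√d∈𝔓 = square∈⇒∈ (subst 𝔓 (square d≡) (absorb (k + + 1 , + 1) 2∈𝔓))

      ⊆𝔓 : ⟨2,1+√d⟩ ⊆ 𝔓
      ⊆𝔓 {_ , y} (q , refl) = subst 𝔓 (identity (+ d)) (∈-lin ideal (ι y) (ι q) 1+√d∈𝔓 2∈𝔓)
        where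
        identity : ∀ D → lin[ D ] (y , + 0) (+ 1 , + 1) (q , + 0) (+ 2 , + 0) ≡ (y + q * + 2 , y)
        identity D = cong₂ _,_ (solve (D ∷ y ∷ q ∷ [])) (solve (y ∷ q ∷ []))

      𝔓⊆ : 𝔓 ⊆ ⟨2,1+√d⟩
      𝔓⊆ {x , y} xy∈𝔓 with parity (x - y * + 1)
      ... | inj₁ (divides q x-y≡) = q , trans (identity x y) (cong (λ t → y + t) x-y≡)
        where
        identity : ∀ x y → x ≡ y + (x - y * + 1)
        identity = solve-∀
      ... | inj₂ (q , x-y≡) = ⊥-elim (proper (subst 𝔓 (cong ι (identity q)) 1∈𝔓))
        where
        odd∈𝔓 : 𝔓 (ι (q * + 2 + + 1))
        odd∈𝔓 = subst (λ n → 𝔓 (ι n)) x-y≡ (ι-eliminate ideal xy∈𝔓 1+√d∈𝔓)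
        1∈𝔓 : 𝔓 (ι (- q * + 2 + + 1 * (q * + 2 + + 1)))
        1∈𝔓 = ι-lin∈ ideal (- q) (+ 1) 2∈𝔓 odd∈𝔓
        identity : ∀ q → - q * + 2 + + 1 * (q * + 2 + + 1) ≡ + 1
        identity = solve-∀

    above-p≐⟨p,√d⟩ : ∀ {p} → Prime p → p ℕ.∣ d → Above 𝔓 p → 𝔓 ≐ ⟨ + p ,√d⟩
    above-p≐⟨p,√d⟩ {p} p-prime (ℕ.divides k d≡kp) p∈𝔓 = 𝔓⊆ , ⊆𝔓
      where
      square : ∀ {D k p} → D ≡ k * p → (k , + 0) ·[ D ] (p , + 0) ≡ (+ 0 , + 1) ·[ D ] (+ 0 , + 1)
      square {k = k} {p} refl = cong₂ _,_ (solve (k ∷ p ∷ [])) (solve (k ∷ p ∷ []))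

      √d∈𝔓 : 𝔓 (+ 0 , + 1)
      √d∈𝔓 = square∈⇒∈ (subst 𝔓 (square {k = + k} {+ p} (pos-≡* k p d≡kp)) (absorb (ι (+ k)) p∈𝔓))

      ⊆𝔓 : ⟨ + p ,√d⟩ ⊆ 𝔓
      ⊆𝔓 {_ , y} (divides a refl) = subst 𝔓 (identity (+ d) (+ p)) (∈-lin ideal (ι a) (ι y) p∈𝔓 √d∈𝔓)
        where
        identity : ∀ D P → lin[ D ] (a , + 0) (P , + 0) (y , + 0) (+ 0 , + 1) ≡ (a * P , y)
        identity D P = cong₂ _,_ (solve (D ∷ P ∷ a ∷ y ∷ [])) (solve (P ∷ a ∷ y ∷ []))

      𝔓⊆ : 𝔓 ⊆ ⟨ + p ,√d⟩
      𝔓⊆ {x , y} xy∈𝔓 with + p ∣? x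
      ... | yes p∣x = p∣x
      ... | no p∤x with Bézout-ℤ x (prime∤⇒coprime p-prime (p∤x ∘ ∣ᵤ⇒∣))
      ...   | X , Y , Xp+Yx≡1 = ⊥-elim (proper (subst (λ n → 𝔓 (ι n)) Xp+Yx≡1 (ι-lin∈ ideal X Y p∈𝔓 x∈𝔓)))
        where
        identity : ∀ x y → x - y * + 0 ≡ x
        identity = solve-∀
        x∈𝔓 : 𝔓 (ι x)
        x∈𝔓 = subst (λ n → 𝔓 (ι n)) (identity x y) (ι-eliminate ideal xy∈𝔓 √d∈𝔓)

  ⟨m,√d⟩·⟨n,√d⟩≐⟨mn,√d⟩ : ∀ {d m n} → Coprime m n → m ℕ.* n ℕ.∣ d →
                         IdealProd d ⟨ + m ,√d⟩ ⟨ + n ,√d⟩ ≐ ⟨ + m * + n ,√d⟩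
  ⟨m,√d⟩·⟨n,√d⟩≐⟨mn,√d⟩ {d} {m} {n} coprime (ℕ.divides K d≡Kmn) =
    IdealProd-⊆ {K = ⟨ + m * + n ,√d⟩} (divides (+ 0) refl) ∣m∣n⇒∣m+n (λ {u} {v} → gen∈ {u} {v}) , ⊇
    where
    d≡ : + d ≡ + K * (+ m * + n)
    d≡ = trans (pos-≡* K (m ℕ.* n) d≡Kmn) (cong (+ K *_) (ℤ.pos-* m n))

    product : ∀ {D K M N} → D ≡ K * (M * N) → ∀ a y b y′ →
              (a * M , y) ·[ D ] (b * N , y′) ≡ ((a * b + K * (y * y′)) * (M * N) , a * M * y′ + y * (b * N))
    product {K = K} {M} {N} refl a y b y′ = cong₂ _,_ (solve (K ∷ M ∷ N ∷ a ∷ y ∷ b ∷ y′ ∷ [])) refl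

    gen∈ : ∀ {u v} → ⟨ + m ,√d⟩ u → ⟨ + n ,√d⟩ v → ⟨ + m * + n ,√d⟩ (u ·[ + d ] v)
    gen∈ {_ , y} {_ , y′} (divides a refl) (divides b refl) =
      subst ⟨ + m * + n ,√d⟩ (sym (product {K = + K} {+ m} {+ n} d≡ a y b y′)) (divides (a * b + + K * (y * y′)) refl)

    ⊇ : ⟨ + m * + n ,√d⟩ ⊆ IdealProd d ⟨ + m ,√d⟩ ⟨ + n ,√d⟩
    ⊇ {_ , y} (divides a refl) with Bézout-ℕ coprime
    ... | X , Y , Xm+Yn≡1 = subst (IdealProd d ⟨ + m ,√d⟩ ⟨ + n ,√d⟩) (decomposition (+ d) (+ m) (+ n) Xm+Yn≡1)
      (plus (gen {a = + m , + 0} {b = a * + n , X * y} (divides (+ 1) (sym (ℤ.*-identityˡ (+ m)))) (divides a refl))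
            (gen {a = + 0 , Y * y} {b = + n , + 0} (divides (+ 0) refl) (divides (+ 1) (sym (ℤ.*-identityˡ (+ n))))))
      where
      decomposition : ∀ D M N → X * M + Y * N ≡ + 1 →
                      lin[ D ] (M , + 0) (a * N , X * y) (+ 0 , Y * y) (N , + 0) ≡ (a * (M * N) , y)
      decomposition D M N XM+YN≡1 = cong₂ _,_ (solve (D ∷ M ∷ N ∷ a ∷ X ∷ Y ∷ y ∷ [])) (begin
        _                   ≡⟨ solve (M ∷ N ∷ a ∷ X ∷ Y ∷ y ∷ []) ⟩
        (X * M + Y * N) * y ≡⟨ cong (_* y) XM+YN≡1 ⟩
        + 1 * y             ≡⟨ ℤ.*-identityˡ y ⟩
        y                   ∎)
        where open ≡-Reasoning

  prodIdeal≐⟨∏p,√d⟩ : ∀ {d r} → SquareFree d → (p : Fin r → ℕ) (Ps : Fin r → SubK) → (∀ i → Prime (p i)) →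
                      (∀ i → IsPrimeIdeal d (Ps i) × Above (Ps i) (p i)) → prodℕ p ℕ.∣ d →
                      prodIdeal d Ps ≐ ⟨ + prodℕ p ,√d⟩
  prodIdeal≐⟨∏p,√d⟩ {r = zero} _ _ _ _ _ _ = (λ {z} _ → divides (proj₁ z) (sym (ℤ.*-identityʳ _))) , λ _ → tt
  prodIdeal≐⟨∏p,√d⟩ {d} {suc r} squarefree p Ps primes Ps-above ∏p∣d =
    ≐-trans (IdealProd-cong (above-p≐⟨p,√d⟩ (proj₁ (Ps-above zero)) (primes zero) p₀∣d (proj₂ (Ps-above zero))) rest)
            (subst (λ M → IdealProd d ⟨ + p₀ ,√d⟩ ⟨ + R ,√d⟩ ≐ ⟨ M ,√d⟩) (sym (ℤ.pos-* p₀ R))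
                   (⟨m,√d⟩·⟨n,√d⟩≐⟨mn,√d⟩ (prime∤⇒coprime (primes zero) p₀∤R) ∏p∣d))
    where
    p₀ R : ℕ
    p₀ = p zero
    R = prodℕ (p ∘ suc)
    rest : prodIdeal d (Ps ∘ suc) ≐ ⟨ + R ,√d⟩
    rest = prodIdeal≐⟨∏p,√d⟩ squarefree (p ∘ suc) (Ps ∘ suc) (primes ∘ suc) (Ps-above ∘ suc) (ℕ.∣-trans (ℕ.n∣m*n p₀) ∏p∣d)
    p₀∣d : p₀ ℕ.∣ d
    p₀∣d = ℕ.∣-trans (ℕ.m∣m*n R) ∏p∣d
    p₀∤R : ¬ p₀ ℕ.∣ R
    p₀∤R p₀∣R = ¬prime[1] (subst Prime (squarefree p₀ (ℕ.∣-trans (ℕ.*-monoʳ-∣ p₀ p₀∣R) ∏p∣d)) (primes zero))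

  -- The lattice ℤ(c + √d) + ℤ(c − √d)

  ℤ⟨_±√d⟩ : ℤ → SubK
  ℤ⟨ c ±√d⟩ (x , y) = ∃[ b ] x ≡ (y + b * + 2) * c

  ℤ⟨±√d⟩-⊕ : ∀ {c u v} → ℤ⟨ c ±√d⟩ u → ℤ⟨ c ±√d⟩ v → ℤ⟨ c ±√d⟩ (u ⊕ v)
  ℤ⟨±√d⟩-⊕ {c} {_ , y} {_ , y′} (b , refl) (b′ , refl) = b + b′ , identity c y b y′ b′
    where
    identity : ∀ c y b y′ b′ → (y + b * + 2) * c + (y′ + b′ * + 2) * c ≡ (y + y′ + (b + b′) * + 2) * c
    identity = solve-∀

  product∈ℤ⟨±√d⟩ : ∀ {C E D} → Odd C → Odd E → D ≡ C * E → ∀ y q a y′ →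
                   let s = y + q * + 2 in ℤ⟨ C ±√d⟩ (s * (a * C) + D * (y * y′) , s * y′ + y * (a * C))
  product∈ℤ⟨±√d⟩ (c , refl) (e , refl) refl y q a y′ =
    q * a + e * y * y′ - q * y′ - c * y * a , solve (c ∷ e ∷ y ∷ q ∷ a ∷ y′ ∷ [])

  ℤ⟨±√d⟩-absorb : ∀ {C E D} → Odd C → Odd E → D ≡ C * E → ∀ y b w w′ →
                  let s = y + b * + 2 in ℤ⟨ C ±√d⟩ (s * C * w + D * (y * w′) , s * C * w′ + y * w)
  ℤ⟨±√d⟩-absorb {C} (c , refl) (e , refl) refl y b w w′ =
    b * w + (e - c) * y * w′ - b * C * w′ , solve (c ∷ e ∷ y ∷ b ∷ w ∷ w′ ∷ [])

  ℤ⟨±√d⟩-decomposition : ∀ {C E D} → Odd E → D ≡ C * E → ∀ y b → ∃[ s ]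
                         lin[ D ] (+ 1 , + 1) (+ 0 , y) (+ 2 , + 0) (s * C , + 0) ≡ ((y + b * + 2) * C , y)
  ℤ⟨±√d⟩-decomposition {C} (e , refl) refl y b =
    b - e * y , cong₂ _,_ (solve (C ∷ e ∷ y ∷ b ∷ [])) (solve (C ∷ e ∷ y ∷ b ∷ []))

  ⟨2,1+√d⟩·⟨c,√d⟩≐ℤ⟨c±√d⟩ : ∀ {d C E} → Odd C → Odd E → + d ≡ C * E →
                            IdealProd d ⟨2,1+√d⟩ ⟨ C ,√d⟩ ≐ ℤ⟨ C ±√d⟩
  ⟨2,1+√d⟩·⟨c,√d⟩≐ℤ⟨c±√d⟩ {d} {C} C-odd E-odd d≡CE =
    IdealProd-⊆ {K = ℤ⟨ C ±√d⟩} (+ 0 , refl) (λ {u} {v} → ℤ⟨±√d⟩-⊕ {C} {u} {v}) (λ {u} {v} → gen∈ {u} {v}) , ⊇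
    where
    gen∈ : ∀ {u v} → ⟨2,1+√d⟩ u → ⟨ C ,√d⟩ v → ℤ⟨ C ±√d⟩ (u ·[ + d ] v)
    gen∈ {_ , y} {_ , y′} (q , refl) (divides a refl) = product∈ℤ⟨±√d⟩ C-odd E-odd d≡CE y q a y′

    ⊇ : ℤ⟨ C ±√d⟩ ⊆ IdealProd d ⟨2,1+√d⟩ ⟨ C ,√d⟩
    ⊇ {_ , y} (b , refl) with ℤ⟨±√d⟩-decomposition E-odd d≡CE y b
    ... | s , decomposition = subst (IdealProd d ⟨2,1+√d⟩ ⟨ C ,√d⟩) decomposition
      (plus (gen {a = + 1 , + 1} {b = + 0 , y} (+ 0 , refl) (divides (+ 0) refl))
            (gen {a = + 2 , + 0} {b = s * C , + 0} (+ 1 , refl) (divides s refl)))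

  det-ℤ⟨±√d⟩ : ∀ {C z z′} → ℤ⟨ C ±√d⟩ z → ℤ⟨ C ±√d⟩ z′ → C * + 2 ∣ det z z′
  det-ℤ⟨±√d⟩ {C} {_ , y} {_ , y′} (b , refl) (b′ , refl) = divides (b * y′ - y * b′) (identity C y b y′ b′)
    where
    identity : ∀ C y b y′ b′ → (y + b * + 2) * C * y′ - y * ((y′ + b′ * + 2) * C) ≡ (b * y′ - y * b′) * (C * + 2)
    identity = solve-∀

  N-ℤ⟨±√d⟩ : ∀ {C E D} → D ≡ C * E → ∀ y b → let s = y + b * + 2 in
             N[ D ] (s * C , y) ≡ C * (s * s * C - y * y * E)
  N-ℤ⟨±√d⟩ {C} {E} refl y b = identity C E (y + b * + 2) y
    where
    identity : ∀ C E s y → s * C * (s * C) - C * E * (y * y) ≡ C * (s * s * C - y * y * E)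
    identity = solve-∀

  -- w = ρ z γ̄ / 2c for γ = sc + k√d and z = s′c + y√d; since γ γ̄ = −c σ, 2 γ w = −ρ σ z = 2 z.
  ℤ⟨±√d⟩-quotient : ∀ {C E D} → Odd C → Odd E → D ≡ C * E → ∀ k t ρ → let s = k + t * + 2 in
                    ρ * (k * k * E - s * s * C) ≡ - + 2 →
                    ∀ y b → ∃[ w ] (s * C , k) ·[ D ] w ≡ ((y + b * + 2) * C , y)
  ℤ⟨±√d⟩-quotient (c , refl) (e , refl) refl k t ρ ρσ≡-2 y b =
    let C = c * + 2 + + 1
        E = e * + 2 + + 1
        s = k + t * + 2
        s′ = y + b * + 2
        u₁ = y * t + b * k + b * t * + 2 + c * s′ * s - e * y * k
        u₂ = y * t - b * k
        halve : ∀ {x x′} → + 2 * x ≡ - (ρ * (k * k * E - s * s * C)) * x′ → x ≡ x′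
        halve {x} {x′} 2x≡ = ℤ.*-cancelˡ-≡ (+ 2) x x′ (trans 2x≡ (cong (λ r → - r * x′) ρσ≡-2))
    in (ρ * u₁ , ρ * u₂) ,
       cong₂ _,_ (halve (solve (c ∷ e ∷ k ∷ t ∷ ρ ∷ y ∷ b ∷ []))) (halve (solve (c ∷ e ∷ k ∷ t ∷ ρ ∷ y ∷ b ∷ [])))

  -- The equation k² e − ℓ² c = ±2

  infix 4 _≡±2
  _≡±2 : ℤ → Set
  n ≡±2 = n ≡ + 2 ⊎ n ≡ - + 2

  Solvable : ℕ → ℕ → Set
  Solvable c e = ∃[ k ] ∃[ ℓ ] k * k * + e - ℓ * ℓ * + c ≡±2

  Solvable-swap : ∀ {c e} → Solvable c e → Solvable e c
  Solvable-swap {c} {e} (k , ℓ , σ≡±2) = ℓ , k , Sum.map negate negate (Sum.swap σ≡±2)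
    where
    identity : ∀ k ℓ c e → ℓ * ℓ * c - k * k * e ≡ - (k * k * e - ℓ * ℓ * c)
    identity = solve-∀
    negate : ∀ {n} → k * k * + e - ℓ * ℓ * + c ≡ n → ℓ * ℓ * + c - k * k * + e ≡ - n
    negate σ≡n = trans (identity k ℓ (+ c) (+ e)) (cong -_ σ≡n)

  odd-¬≡±2 : ∀ {n} → Odd n → ¬ n ≡±2
  odd-¬≡±2 (w , n≡) (inj₁ n≡2)  = odd≢even w (+ 1) (trans (sym n≡) n≡2)
  odd-¬≡±2 (w , n≡) (inj₂ n≡-2) = odd≢even w (- + 1) (trans (sym n≡) n≡-2)

  odd-form : ∀ {C E} → Odd C → Odd E → ∀ k q → let ℓ = k + (q * + 2 + + 1) in Odd (k * k * E - ℓ * ℓ * C)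
  odd-form {C} (c , refl) (e , refl) k q =
    k * k * (e - c) - C * (k * q * + 2 + k + q * q * + 2 + q * + 2) - c - + 1 , solve (c ∷ e ∷ k ∷ q ∷ [])

  ±2-inverse : ∀ {σ} → σ ≡±2 → ∃[ ρ ] ρ * σ ≡ - + 2
  ±2-inverse (inj₁ refl) = - + 1 , refl
  ±2-inverse (inj₂ refl) = + 1 , refl

  module Criterion {c e d : ℕ} (c-odd : Odd (+ c)) (e-odd : Odd (+ e)) (d≡ce : d ≡ c ℕ.* e)
                   {I : SubK} (I≐ : I ≐ ℤ⟨ + c ±√d⟩) where

    ω₊ ω₋ : OK
    ω₊ = (+ c , + 1)
    ω₋ = (+ c , - + 1)

    ω₊∈I : I ω₊
    ω₊∈I = proj₂ I≐ (+ 0 , sym (ℤ.*-identityˡ (+ c)))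

    ω₋∈I : I ω₋
    ω₋∈I = proj₂ I≐ (+ 1 , sym (ℤ.*-identityˡ (+ c)))

    c≢0 : + c ≢ + 0
    c≢0 c≡0 = odd≢even (proj₁ c-odd) (+ 0) (trans (sym (proj₂ c-odd)) c≡0)

    1≤c : 1 ℕ.≤ c
    1≤c = ℕ.n≢0⇒n>0 (c≢0 ∘ cong (+_))

    c*2≢0 : + c * + 2 ≢ + 0
    c*2≢0 c*2≡0 = c≢0 (ℤ.*-cancelʳ-≡ (+ c) (+ 0) (+ 2) c*2≡0)

    cancel-c*2 : ∀ {x y} → x * (+ c * + 2) ≡ y * (+ c * + 2) → x ≡ y
    cancel-c*2 {x} {y} = ℤ.*-cancelʳ-≡ x y (+ c * + 2) {{≢-nonZero c*2≢0}}

    halfLenSq-ℤ⟨±√d⟩ : ∀ y b → let S = ∣ y + b * + 2 ∣ in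
                       halfLenSq d ((y + b * + 2) * + c , y) ≡ S ℕ.* c ℕ.* (S ℕ.* c) ℕ.+ d ℕ.* (∣ y ∣ ℕ.* ∣ y ∣)
    halfLenSq-ℤ⟨±√d⟩ y b = cong (λ t → t ℕ.* t ℕ.+ d ℕ.* (∣ y ∣ ℕ.* ∣ y ∣)) (ℤ.abs-* (y + b * + 2) (+ c))

    nonzero-shape : ∀ y b → ((y + b * + 2) * + c , y) ≢ 0K →
                    (∣ y ∣ ≡ 0 → 2 ℕ.≤ ∣ y + b * + 2 ∣) × (∣ y + b * + 2 ∣ ≡ 0 → 2 ℕ.≤ ∣ y ∣)
    nonzero-shape y b z≢0 = y≡0⇒ , s≡0⇒
      where
      b≢0 : y ≡ + 0 → b ≢ + 0
      b≢0 y≡0 b≡0 = z≢0 (cong₂ (λ y b → ((y + b * + 2) * + c , y)) y≡0 b≡0)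
      y≡0⇒ : ∣ y ∣ ≡ 0 → 2 ℕ.≤ ∣ y + b * + 2 ∣
      y≡0⇒ ∣y∣≡0 = subst (λ t → 2 ℕ.≤ ∣ t ∣) (sym (trans (cong (_+ b * + 2) y≡0) (ℤ.+-identityˡ (b * + 2))))
                         (∣b*2∣≥2 (b≢0 y≡0))
        where
        y≡0 : y ≡ + 0
        y≡0 = ℤ.∣i∣≡0⇒i≡0 ∣y∣≡0
      s≡0⇒ : ∣ y + b * + 2 ∣ ≡ 0 → 2 ℕ.≤ ∣ y ∣
      s≡0⇒ ∣s∣≡0 = subst (2 ℕ.≤_) (trans (sym (ℤ.∣-i∣≡∣i∣ (b * + 2))) (cong ∣_∣ (sym y≡-2b)))
                         (∣b*2∣≥2 (λ b≡0 → b≢0 (trans y≡-2b (cong (λ t → - (t * + 2)) b≡0)) b≡0))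
        where
        identity : ∀ y b → y ≡ y + b * + 2 - b * + 2
        identity = solve-∀
        y≡-2b : y ≡ - (b * + 2)
        y≡-2b = trans (identity y b) (trans (cong (_- b * + 2) (ℤ.∣i∣≡0⇒i≡0 {y + b * + 2} ∣s∣≡0)) (ℤ.+-identityˡ _))

    ω₊-shortest : e ℕ.≤ 3 ℕ.* c → c ℕ.≤ 3 ℕ.* e → ∀ β → I β → β ≢ 0K → lenSq d ω₊ ≤ lenSq d β
    ω₊-shortest e≤3c c≤3e (_ , y) β∈I β≢0 with proj₁ I≐ β∈I
    ... | b , refl with nonzero-shape y b β≢0
    ...   | y≡0⇒ , s≡0⇒ = lenSq-≤ {d} ω₊ ((y + b * + 2) * + c , y)
                            (subst (halfLenSq d ω₊ ℕ.≤_) (sym (halfLenSq-ℤ⟨±√d⟩ y b)) (c²+d≤norm d≡ce e≤3c c≤3e y≡0⇒ s≡0⇒))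

    minimalBasis : e ℕ.≤ 3 ℕ.* c → c ℕ.≤ 3 ℕ.* e → MinimalBasis d I ω₊ ω₋
    minimalBasis e≤3c c≤3e = (ω₊ , ω₋ , ω₊-minimal , ω₋-minimal , independent) ,
                             ω₊-minimal , ω₋-minimal , independent , I⊆span
      where
      ω₊-minimal : Minimal d I ω₊
      ω₊-minimal = ω₊∈I , (λ ()) , ω₊-shortest e≤3c c≤3e
      ω₋-minimal : Minimal d I ω₋
      ω₋-minimal = ω₋∈I , (λ ()) , ω₊-shortest e≤3c c≤3e  -- lenSq d ω₋ and lenSq d ω₊ compute to the same value
      independent : Indep ω₊ ω₋
      independent det≡0 = c*2≢0 (ℤ.neg-injective (trans (sym (det-c±√d (+ c))) det≡0))
      span-identity : ∀ C y b → ((y + b * + 2) * C , y) ≡ ((y + b) * C + b * C , (y + b) * + 1 + b * - + 1)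
      span-identity C y b = cong₂ _,_ (solve (C ∷ y ∷ b ∷ [])) (solve (y ∷ b ∷ []))
      I⊆span : ∀ γ → I γ → ∃[ m ] ∃[ n ] γ ≡ (m ⋆ ω₊) ⊕ (n ⋆ ω₋)
      I⊆span (_ , y) γ∈I with proj₁ I≐ γ∈I
      ... | b , refl = y + b , b , span-identity (+ c) y b

    private
      -- 2c, written as (y + 2b)c + y√d with y = 0 and b = 1
      2c : OK
      2c = ((+ 0 + + 1 * + 2) * + c , + 0)

    minimal⇒rational : 3 ℕ.* c ℕ.< e → ∀ {α} → Minimal d I α → proj₂ α ≡ + 0
    minimal⇒rational 3c<e {_ , y} (α∈I , α≢0 , α-shortest) with proj₁ I≐ α∈I
    ... | b , refl with ∣ y ∣ ℕ.≟ 0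
    ...   | yes ∣y∣≡0 = ℤ.∣i∣≡0⇒i≡0 ∣y∣≡0
    ...   | no ∣y∣≢0 = ⊥-elim (ℕ.<⇒≱ 2c<α α≤2c)
      where
      2c<α : halfLenSq d 2c ℕ.< halfLenSq d ((y + b * + 2) * + c , y)
      2c<α = subst₂ ℕ._<_ (sym (halfLenSq-ℤ⟨±√d⟩ (+ 0) (+ 1))) (sym (halfLenSq-ℤ⟨±√d⟩ y b))
               ([2c]²<norm d≡ce 1≤c 3c<e (ℕ.n≢0⇒n>0 ∣y∣≢0) (proj₂ (nonzero-shape y b α≢0)))
      2c≢0 : 2c ≢ 0K
      2c≢0 2c≡0 = c≢0 (ℤ.*-cancelˡ-≡ (+ 2) (+ c) (+ 0) (cong proj₁ 2c≡0))
      α≤2c : halfLenSq d ((y + b * + 2) * + c , y) ℕ.≤ halfLenSq d 2c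
      α≤2c = lenSq-≤⁻ {d} ((y + b * + 2) * + c , y) 2c (α-shortest 2c (proj₂ I≐ (+ 1 , refl)) 2c≢0)

    ¬WR : 3 ℕ.* c ℕ.< e → ¬ WR d I
    ¬WR 3c<e ((x , _) , (x′ , _) , α-minimal , β-minimal , independent)
      with minimal⇒rational 3c<e α-minimal | minimal⇒rational 3c<e β-minimal
    ... | refl | refl = independent (identity x x′)
      where
      identity : ∀ x x′ → x * + 0 - + 0 * x′ ≡ + 0
      identity = solve-∀

    generator∈ : ∀ {γ} → (∀ z → I z ⇔ (∃[ w ] z ≡ _·_ d γ w)) → I γ
    generator∈ {γ} I≡γO = Equivalence.from (I≡γO γ) (1K , sym (·-identityʳ (+ d) γ))

    -- det(γ, γ√d) = N γ is a multiple of 2c = −det(ω₊, ω₋), while ω± = γ w± gives −2c = N γ · det(w₊, w₋).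
    generator-norm : ∀ {γ} → (∀ z → I z ⇔ (∃[ w ] z ≡ _·_ d γ w)) →
                     ∃[ k ] (k ≡ + 1 ⊎ k ≡ - + 1) × N[ + d ] γ ≡ k * (+ c * + 2)
    generator-norm {γ} I≡γO
      with det-ℤ⟨±√d⟩ {z = γ} {γ ·[ + d ] (+ 0 , + 1)} (proj₁ I≐ (generator∈ {γ} I≡γO)) (proj₁ I≐ γ√d∈I)
         | Equivalence.to (I≡γO ω₊) ω₊∈I | Equivalence.to (I≡γO ω₋) ω₋∈I
      where
      γ√d∈I : I (γ ·[ + d ] (+ 0 , + 1))
      γ√d∈I = Equivalence.from (I≡γO (γ ·[ + d ] (+ 0 , + 1))) ((+ 0 , + 1) , refl)
    ... | divides k det≡ | w₊ , ω₊≡ | w₋ , ω₋≡ = k , k*δ≡-1 kδ≡-1 , N≡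
      where
      N≡ : N[ + d ] γ ≡ k * (+ c * + 2)
      N≡ = trans (sym (det-·√d (+ d) γ)) det≡
      kδ≡-1 : k * det w₊ w₋ ≡ - + 1
      kδ≡-1 = cancel-c*2 (begin
        k * det w₊ w₋ * (+ c * + 2)         ≡⟨ identity k (det w₊ w₋) (+ c * + 2) ⟩
        k * (+ c * + 2) * det w₊ w₋         ≡⟨ cong (_* det w₊ w₋) N≡ ⟨
        N[ + d ] γ * det w₊ w₋              ≡⟨ det-· (+ d) γ w₊ w₋ ⟨
        det (γ ·[ + d ] w₊) (γ ·[ + d ] w₋) ≡⟨ cong₂ det ω₊≡ ω₋≡ ⟨
        det ω₊ ω₋                           ≡⟨ det-c±√d (+ c) ⟩
        - (+ c * + 2)                       ≡⟨ ℤ.-1*i≡-i (+ c * + 2) ⟨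
        - + 1 * (+ c * + 2)                 ∎)
        where
        open ≡-Reasoning
        identity : ∀ k δ C2 → k * δ * C2 ≡ k * C2 * δ
        identity = solve-∀

    norm⇒solvable : ∀ y b {k} → k ≡ + 1 ⊎ k ≡ - + 1 →
                    N[ + d ] ((y + b * + 2) * + c , y) ≡ k * (+ c * + 2) → Solvable c e
    norm⇒solvable y b {k} k≡±1 N≡ = y , s , σ≡±2 k≡±1
      where
      s : ℤ
      s = y + b * + 2
      τ≡ : s * s * + c - y * y * + e ≡ k * + 2
      τ≡ = ℤ.*-cancelˡ-≡ (+ c) (s * s * + c - y * y * + e) (k * + 2) {{≢-nonZero c≢0}} (begin
        + c * (s * s * + c - y * y * + e) ≡⟨ N-ℤ⟨±√d⟩ (pos-≡* c e d≡ce) y b ⟨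
        N[ + d ] (s * + c , y)           ≡⟨ N≡ ⟩
        k * (+ c * + 2)                  ≡⟨ identity k (+ c) ⟩
        + c * (k * + 2)                  ∎)
        where
        open ≡-Reasoning
        identity : ∀ k c → k * (c * + 2) ≡ c * (k * + 2)
        identity = solve-∀
      σ≡-τ : ∀ s y c e → y * y * e - s * s * c ≡ - (s * s * c - y * y * e)
      σ≡-τ = solve-∀
      σ≡±2 : k ≡ + 1 ⊎ k ≡ - + 1 → y * y * + e - s * s * + c ≡±2
      σ≡±2 (inj₁ refl) = inj₂ (trans (σ≡-τ s y (+ c) (+ e)) (cong -_ τ≡))
      σ≡±2 (inj₂ refl) = inj₁ (trans (σ≡-τ s y (+ c) (+ e)) (cong -_ τ≡))

    principal⇒solvable : Principal d I → Solvable c e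
    principal⇒solvable ((x , y) , I≡γO) with proj₁ I≐ (generator∈ {x , y} I≡γO)
    ... | b , refl = norm⇒solvable y b (proj₁ (proj₂ norm)) (proj₂ (proj₂ norm))
      where
      norm : ∃[ k ] (k ≡ + 1 ⊎ k ≡ - + 1) × N[ + d ] ((y + b * + 2) * + c , y) ≡ k * (+ c * + 2)
      norm = generator-norm {(y + b * + 2) * + c , y} I≡γO

    solvable⇒principal : Solvable c e → Principal d I
    solvable⇒principal (k , ℓ , σ≡±2) with relative-parity k ℓ
    ... | inj₂ (q , refl) = ⊥-elim (odd-¬≡±2 (odd-form c-odd e-odd k q) σ≡±2)
    ... | inj₁ (t , refl) = γ , λ z → mk⇔ (I⊆γO z) (γO⊆I z)
      where
      γ : OK
      γ = ((k + t * + 2) * + c , k)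
      ρ : ℤ
      ρ = proj₁ (±2-inverse σ≡±2)
      ρσ≡-2 : ρ * (k * k * + e - (k + t * + 2) * (k + t * + 2) * + c) ≡ - + 2
      ρσ≡-2 = proj₂ (±2-inverse σ≡±2)
      I⊆γO : ∀ z → I z → ∃[ w ] z ≡ _·_ d γ w
      I⊆γO (_ , y) z∈I with proj₁ I≐ z∈I
      ... | b , refl with ℤ⟨±√d⟩-quotient c-odd e-odd (pos-≡* c e d≡ce) k t ρ ρσ≡-2 y b
      ...   | w , γw≡z = w , sym γw≡z
      γO⊆I : ∀ z → (∃[ w ] z ≡ _·_ d γ w) → I z
      γO⊆I _ ((w , w′) , refl) = proj₂ I≐ (ℤ⟨±√d⟩-absorb c-odd e-odd (pos-≡* c e d≡ce) k t w w′)

  P·∏Pᵢ≐ℤ⟨c±√d⟩ : ∀ {d c e r} → SquareFree d → Odd (+ c) → Odd (+ e) → d ≡ c ℕ.* e →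
                  (p : Fin r → ℕ) (Ps : Fin r → SubK) → (∀ i → Prime (p i)) → prodℕ p ≡ c →
                  (∀ i → IsPrimeIdeal d (Ps i) × Above (Ps i) (p i)) →
                  ∀ {P} → IsPrimeIdeal d P → Above P 2 → IdealProd d P (prodIdeal d Ps) ≐ ℤ⟨ + c ±√d⟩
  P·∏Pᵢ≐ℤ⟨c±√d⟩ {d} {c} {e} squarefree c-odd e-odd d≡ce p Ps primes ∏p≡c Ps-above P-prime 2∈P =
    ≐-trans (IdealProd-cong (above-2≐⟨2,1+√d⟩ P-prime d-odd 2∈P) ∏Pᵢ≐)
            (⟨2,1+√d⟩·⟨c,√d⟩≐ℤ⟨c±√d⟩ c-odd e-odd (pos-≡* c e d≡ce))
    where
    d-odd : Odd (+ d)
    d-odd = subst Odd (sym (pos-≡* c e d≡ce)) (Odd-* c-odd e-odd)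
    ∏p∣d : prodℕ p ℕ.∣ d
    ∏p∣d = subst (ℕ._∣ d) (sym ∏p≡c) (ℕ.divides e (trans d≡ce (ℕ.*-comm c e)))
    ∏Pᵢ≐ : prodIdeal d Ps ≐ ⟨ + c ,√d⟩
    ∏Pᵢ≐ = subst (λ m → prodIdeal d Ps ≐ ⟨ + m ,√d⟩) ∏p≡c (prodIdeal≐⟨∏p,√d⟩ squarefree p Ps primes Ps-above ∏p∣d)

open import Data.Nat using (ℕ; _<_; _≤_; _*_; _%_)
open import Data.Nat.Primality using (Prime)
open import Data.Integer as ℤ using (ℤ; +_; -_)
open import Data.Fin using (Fin)
open import Data.Product using (∃-syntax; _×_; _,_; proj₁; proj₂)
open import Data.Sum using (_⊎_)
open import Relation.Binary.PropositionalEquality using (_≡_; sym; trans)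
open import Function.Bundles using (_⇔_; mk⇔)
open import Data.Nat.Properties using (*-comm; ≮⇒≥; ≤-trans; <⇒≤; m≤n*m)
open import Relation.Unary using (_≐_)
open ℤ[√d] using (Odd; Odd-factor; %4≡3⇒Odd; ℤ⟨_±√d⟩; P·∏Pᵢ≐ℤ⟨c±√d⟩; Solvable-swap; module Criterion)

proposition3p3 :
  (d d₁ d₂ : ℕ) → 1 < d → SquareFree d → d % 4 ≡ 3 →
  0 < d₁ → d₁ * d₂ ≡ d → d₁ < d₂ →
  (r s : ℕ) (p : Fin r → ℕ) (q : Fin s → ℕ) →
  (∀ i → Prime (p i)) → prodℕ p ≡ d₁ →
  (∀ j → Prime (q j)) → prodℕ q ≡ d₂ →
  (P : SubK) (Ps : Fin r → SubK) (Qs : Fin s → SubK) →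
  IsPrimeIdeal d P → Above P 2 →
  (∀ i → IsPrimeIdeal d (Ps i) × Above (Ps i) (p i)) →
  (∀ j → IsPrimeIdeal d (Qs j) × Above (Qs j) (q j)) →
  let I₁ = IdealProd d P (prodIdeal d Ps)
      I₂ = IdealProd d P (prodIdeal d Qs)
  in ((PWR d I₁ × PWR d I₂) ⇔
        (d₂ ≤ 3 * d₁ ×
         ∃[ k ] ∃[ ℓ ] (k ℤ.* k ℤ.* + d₂ ℤ.- ℓ ℤ.* ℓ ℤ.* + d₁ ≡ + 2
                        ⊎ k ℤ.* k ℤ.* + d₂ ℤ.- ℓ ℤ.* ℓ ℤ.* + d₁ ≡ - + 2)))
     × (PWR d I₁ × PWR d I₂ →
          MinimalBasis d I₁ (+ d₁ , + 1) (+ d₁ , - + 1)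
        × MinimalBasis d I₂ (+ d₂ , + 1) (+ d₂ , - + 1))
proposition3p3 d d₁ d₂ _ squarefree d%4≡3 _ d₁d₂≡d d₁<d₂ r s p q p-prime ∏p≡d₁ q-prime ∏q≡d₂
               P Ps Qs P-prime 2∈P Ps-above Qs-above =
  mk⇔ (λ (pwr₁ , _) → WR₁⇒d₂≤3d₁ (proj₂ pwr₁) , I₁.principal⇒solvable (proj₁ pwr₁))
      (λ (d₂≤3d₁ , solvable) → (I₁.solvable⇒principal solvable , proj₁ (I₁.minimalBasis d₂≤3d₁ d₁≤3d₂))
                             , (I₂.solvable⇒principal (Solvable-swap solvable) , proj₁ (I₂.minimalBasis d₁≤3d₂ d₂≤3d₁))) ,
  λ (pwr₁ , _) → I₁.minimalBasis (WR₁⇒d₂≤3d₁ (proj₂ pwr₁)) d₁≤3d₂ , I₂.minimalBasis d₁≤3d₂ (WR₁⇒d₂≤3d₁ (proj₂ pwr₁))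
  where
  d₂d₁≡d : d₂ * d₁ ≡ d
  d₂d₁≡d = trans (*-comm d₂ d₁) d₁d₂≡d
  d-odd : Odd (+ d)
  d-odd = %4≡3⇒Odd d%4≡3
  d₁-odd : Odd (+ d₁)
  d₁-odd = Odd-factor d₁d₂≡d d-odd
  d₂-odd : Odd (+ d₂)
  d₂-odd = Odd-factor d₂d₁≡d d-odd
  I₁≐ : IdealProd d P (prodIdeal d Ps) ≐ ℤ⟨ + d₁ ±√d⟩
  I₁≐ = P·∏Pᵢ≐ℤ⟨c±√d⟩ squarefree d₁-odd d₂-odd (sym d₁d₂≡d) p Ps p-prime ∏p≡d₁ Ps-above P-prime 2∈P
  I₂≐ : IdealProd d P (prodIdeal d Qs) ≐ ℤ⟨ + d₂ ±√d⟩
  I₂≐ = P·∏Pᵢ≐ℤ⟨c±√d⟩ squarefree d₂-odd d₁-odd (sym d₂d₁≡d) q Qs q-prime ∏q≡d₂ Qs-above P-prime 2∈P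
  module I₁ = Criterion d₁-odd d₂-odd (sym d₁d₂≡d) I₁≐
  module I₂ = Criterion d₂-odd d₁-odd (sym d₂d₁≡d) I₂≐
  d₁≤3d₂ : d₁ ≤ 3 * d₂
  d₁≤3d₂ = ≤-trans (<⇒≤ d₁<d₂) (m≤n*m d₂ 3)
  WR₁⇒d₂≤3d₁ : WR d (IdealProd d P (prodIdeal d Ps)) → d₂ ≤ 3 * d₁
  WR₁⇒d₂≤3d₁ wr = ≮⇒≥ (λ 3d₁<d₂ → I₁.¬WR 3d₁<d₂ wr)
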